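{- Let $U$ be a countably infinite set and $\mathrm{G}$ a subgroup of $\mathfrak{S}(U)$. Then $\overline{\mathrm{G}}[U]=\{U\}$ (equivalently, every $f\in\overline{\mathrm{G}}$ is a bijection of $U$) if and only if every point orbit of $\mathrm{G}$ is ranked, i.e. the type $\langle\emptyset\mid x\rangle$ is ranked for every $x\in U$.
   Context: $\overline{\mathrm{G}}$ is the closure of $\mathrm{G}$ in $U^U$ for the function topology (maps $f:U\to U$ such that every finite restriction of $f$ is a restriction of some $g\in\mathrm{G}$); $\overline{\mathrm{G}}[U]=\{f[U]\mid f\in\overline{\mathrm{G}}\}$. For $F\subseteq U$, $\mathrm{G}\langle F\rangle=\{g\in\mathrm{G}\mid g(x)=x\ \forall x\in F\}$. A type is a pair $\langle F\mid p\rangle$ with $F$ a finite subset of $U$ and $p\in U$; its typeset is $\mathrm{G}\langle F\mid p\rangle=\{g(p)\mid g\in\mathrm{G}\langle F\rangle\}$ (so $\mathrm{G}\langle\emptyset\mid x\rangle$ is the $\mathrm{G}$-orbit of $x$). $\mathfrak{R}_0$ is the set of types with finite typeset; $\langle F\mid p\rangle\in\mathfrak{R}_\alpha$ if there is a finite $F'\supseteq F$ such that for every $q\in\mathrm{G}\langle F\mid p\rangle$, $\langle F'\mid q\rangle\in\mathfrak{R}_\beta$ for some $\beta<\alpha$. A type is ranked if it lies in some $\mathfrak{R}_\alpha$. -}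

module Defs where

open import Data.List using (List)
open import Data.List.Membership.Propositional using (_∈_)
open import Data.Product using (Σ; ∃; _×_)
open import Relation.Binary.PropositionalEquality using (_≡_)

record IsSubgroupOfSym (U : Set) (G : (U → U) → Set) : Set where
  field
    bijective  : ∀ {g} → G g → Σ (U → U) λ h →
                   (∀ x → h (g x) ≡ x) × (∀ x → g (h x) ≡ x)
    -- G is a set of functions: closed under pointwise equality
    extensional : ∀ {g h} → G g → (∀ x → g x ≡ h x) → G h
    id-closed  : G (λ x → x)
    ∘-closed   : ∀ {g h} → G g → G h → G (λ x → g (h x))
    inv-closed : ∀ {g} → G g → Σ (U → U) λ h → G h × (∀ x → h (g x) ≡ x) × (∀ x → g (h x) ≡ x)

module _ {U : Set} (G : (U → U) → Set) where

  -- f ∈ Ḡ : every finite restriction of f is a restriction of some g ∈ G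
  InClosure : (U → U) → Set
  InClosure f = (F : List U) → Σ (U → U) λ g → G g × (∀ {x} → x ∈ F → f x ≡ g x)

  ImageIsU : (U → U) → Set
  ImageIsU f = ∀ y → ∃ λ x → f x ≡ y

  Fixes : List U → (U → U) → Set
  Fixes F g = G g × (∀ {x} → x ∈ F → g x ≡ x)

  InTypeset : List U → U → U → Set
  InTypeset F p q = ∃ λ g → Fixes F g × g p ≡ q

  FiniteSubset : (U → Set) → Set
  FiniteSubset S = ∃ λ (xs : List U) → ∀ {y} → S y → y ∈ xs

  -- ⟨F ∣ p⟩ is ranked, i.e. lies in ⋃_α 𝔑_α (inductive = union of the
  -- ordinal hierarchy):
  --   rank0 : typeset finite (𝔑₀)
  --   rankS : some finite F' ⊇ F with ⟨F' ∣ q⟩ ranked for all q ∈ G⟨F ∣ p⟩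
  data Ranked (F : List U) (p : U) : Set where
    rank0 : FiniteSubset (InTypeset F p) → Ranked F p
    rankS : (F' : List U) → (∀ {x} → x ∈ F → x ∈ F') →
            (∀ q → InTypeset F p q → Ranked F' q) → Ranked F p

module Submission where

-- If every point orbit is ranked then, by induction on the rank of ⟨F ∣ p⟩, every f ∈ Ḡ
-- fixing F hits p.  An f ∈ Ḡ fixing F maps the typeset G⟨F ∣ p⟩
-- into itself and is injective, so if that typeset is finite the forward f-orbit of p
-- repeats and, cancelling, returns to p.  Otherwise pick g ∈ G agreeing with f on the
-- larger set F'; g⁻¹ ∘ f ∈ Ḡ fixes F' and g⁻¹ p lies in the typeset, so the induction
-- hypothesis gives a preimage of g⁻¹ p under g⁻¹ ∘ f.
--
-- Conversely, if ⟨∅ ∣ p⟩ is unranked then (classically) for every unranked ⟨E ∣ p⟩ and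
-- every c there is h ∈ G⟨E⟩ with ⟨h c ∷ E ∣ p⟩ still unranked.  Enumerating U as
-- u₀, u₁, … and composing such h's sends u₀, …, uₙ₋₁ into an unranked Eₙ that later
-- steps fix, so the compositions converge pointwise to some f ∈ Ḡ with f[U] ⊆ ⋃ Eₙ.
-- Since p ∈ E would give ⟨E ∣ p⟩ the singleton typeset {p}, f misses p.

open import Defs
open import Axiom.ExcludedMiddle using (ExcludedMiddle)
open import Data.Empty using (⊥-elim)
open import Data.Fin using (Fin; toℕ)
open import Data.Fin.Properties using (pigeonhole)
open import Data.List using (List; []; _∷_; _++_; map; length; lookup)
open import Data.List.Extrema.Nat using (max; xs≤max)
open import Data.List.Membership.Propositional using (_∈_)
open import Data.List.Membership.Propositional.Properties using (∈-++⁺ˡ; ∈-++⁺ʳ; ∈-map⁺; ∈-map⁻)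
open import Data.List.Relation.Binary.Subset.Propositional using (_⊆_)
open import Data.List.Relation.Binary.Subset.Propositional.Properties using (map⁺)
import Data.List.Relation.Unary.All as All
open import Data.List.Relation.Unary.Any using (here; there; index)
open import Data.List.Relation.Unary.Any.Properties using (lookup-index)
open import Data.Nat using (ℕ; suc; _+_; _<_; s≤s)
open import Data.Nat.GeneralisedArithmetic using (fold; fold-+)
open import Data.Nat.Properties using (≤-refl; m≤n⇒m<n∨m≡n; m≤n⇒∃[o]m+o≡n; +-suc)
open import Data.Product using (∃; _×_; _,_; proj₁; proj₂)
open import Data.Sum using (inj₁; inj₂)
open import Function using (_∘_; _⇔_; mk⇔)
open import Function.Bundles using (_↔_; Inverse)
open import Function.Definitions using (Injective)
open import Level using (0ℓ)
open import Relation.Nullary using (¬_; yes; no)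
open import Relation.Binary.PropositionalEquality
  using (_≡_; _≢_; refl; sym; trans; cong; subst; module ≡-Reasoning)

module _ {A : Set} {f : A → A} (f-injective : Injective _≡_ _≡_ f) where

  fold-injective : ∀ n {a b} → fold a f n ≡ fold b f n → a ≡ b
  fold-injective 0       eq = eq
  fold-injective (suc n) eq = fold-injective n (f-injective eq)

  finite-orbit⇒preimage : ∀ {p} (xs : List A) → (∀ n → fold p f n ∈ xs) → ∃ λ u → f u ≡ p
  finite-orbit⇒preimage {p} xs orbit⊆xs =
    let i , j , i<j , same-position = pigeonhole ≤-refl position
    in returns (toℕ i) (toℕ j) i<j (same-value i j same-position)
    where
    position : Fin (suc (length xs)) → Fin (length xs)
    position i = index (orbit⊆xs (toℕ i))

    same-value : ∀ i j → position i ≡ position j → fold p f (toℕ i) ≡ fold p f (toℕ j)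
    same-value i j eq = trans (lookup-index (orbit⊆xs (toℕ i)))
      (trans (cong (lookup xs) eq) (sym (lookup-index (orbit⊆xs (toℕ j)))))

    returns : ∀ i j → i < j → fold p f i ≡ fold p f j → ∃ λ u → f u ≡ p
    returns i (suc j) (s≤s i≤j) eq with m≤n⇒∃[o]m+o≡n i≤j
    ... | d , refl = fold p f d , sym (fold-injective i (begin
          fold p f i                       ≡⟨ eq ⟩
          fold p f (suc (i + d))           ≡⟨ cong (fold p f) (+-suc i d) ⟨
          fold p f (i + suc d)             ≡⟨ fold-+ p f i ⟩
          fold (fold p f (suc d)) f i      ∎))
      where open ≡-Reasoning

module Ranks {U : Set} (G : (U → U) → Set) (S : IsSubgroupOfSym U G) where
  open IsSubgroupOfSym S

  module _ {g : U → U} (g∈G : G g) where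
    inverse : U → U
    inverse = proj₁ (inv-closed g∈G)

    inverse∈G : G inverse
    inverse∈G = proj₁ (proj₂ (inv-closed g∈G))

    inverse-cancelˡ : ∀ x → inverse (g x) ≡ x
    inverse-cancelˡ = proj₁ (proj₂ (proj₂ (inv-closed g∈G)))

    inverse-cancelʳ : ∀ x → g (inverse x) ≡ x
    inverse-cancelʳ = proj₂ (proj₂ (proj₂ (inv-closed g∈G)))

  inverse-fixes : ∀ {g F} (g∈G : G g) → (∀ {x} → x ∈ F → g x ≡ x) → Fixes G F (inverse g∈G)
  inverse-fixes g∈G fixes =
    inverse∈G g∈G , λ {x} x∈F → trans (cong (inverse g∈G) (sym (fixes x∈F))) (inverse-cancelˡ g∈G x)

  InTypeset-antitone : ∀ {F F' p q} → F ⊆ F' → InTypeset G F' p q → InTypeset G F p q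
  InTypeset-antitone F⊆F' (g , (g∈G , fixes) , gp≡q) = g , (g∈G , fixes ∘ F⊆F') , gp≡q

  InTypeset-conjugate : ∀ {k F p q} (k∈G : G k) →
    InTypeset G (map k F) (k p) q → InTypeset G F p (inverse k∈G q)
  InTypeset-conjugate {k} k∈G (g , (g∈G , fixes) , gkp≡q) =
    (inverse k∈G) ∘ g ∘ k ,
    (∘-closed (inverse∈G k∈G) (∘-closed g∈G k∈G) ,
     λ {x} x∈F → trans (cong (inverse k∈G) (fixes (∈-map⁺ k x∈F))) (inverse-cancelˡ k∈G x)) ,
    cong (inverse k∈G) gkp≡q

  Ranked-∈ : ∀ {F p} → p ∈ F → Ranked G F p
  Ranked-∈ p∈F = rank0 (_ ∷ [] , λ (g , (_ , fixes) , gp≡q) → here (trans (sym gp≡q) (fixes p∈F)))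

  Ranked-weaken : ∀ {F F' p} → F ⊆ F' → Ranked G F p → Ranked G F' p
  Ranked-weaken F⊆F' (rank0 (xs , covered)) =
    rank0 (xs , covered ∘ InTypeset-antitone F⊆F')
  Ranked-weaken {F' = F'} F⊆F' (rankS F₁ F⊆F₁ ranked) =
    rankS (F' ++ F₁) ∈-++⁺ˡ λ q q∈ →
      Ranked-weaken (∈-++⁺ʳ F') (ranked q (InTypeset-antitone F⊆F' q∈))

  Ranked-map : ∀ {k F p} → G k → Ranked G F p → Ranked G (map k F) (k p)
  Ranked-map {k} k∈G (rank0 (xs , covered)) =
    rank0 (map k xs , λ {q} q∈ →
      subst (_∈ map k xs) (inverse-cancelʳ k∈G q) (∈-map⁺ k (covered (InTypeset-conjugate k∈G q∈))))
  Ranked-map {k} k∈G (rankS F' F⊆F' ranked) =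
    rankS (map k F') (map⁺ k F⊆F') λ q q∈ →
      subst (Ranked G (map k F')) (inverse-cancelʳ k∈G q)
        (Ranked-map k∈G (ranked _ (InTypeset-conjugate k∈G q∈)))

  InClosure-injective : ∀ {f} → InClosure G f → Injective _≡_ _≡_ f
  InClosure-injective f∈Ḡ {a} {b} fa≡fb with f∈Ḡ (a ∷ b ∷ [])
  ... | g , g∈G , agrees = begin
    a                  ≡⟨ inverse-cancelˡ g∈G a ⟨
    inverse g∈G (g a)  ≡⟨ cong (inverse g∈G) (trans (sym (agrees (here refl)))
                            (trans fa≡fb (agrees (there (here refl))))) ⟩
    inverse g∈G (g b)  ≡⟨ inverse-cancelˡ g∈G b ⟩
    b                  ∎
    where open ≡-Reasoning

  InClosure-∘ : ∀ {g f} → G g → InClosure G f → InClosure G (g ∘ f)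
  InClosure-∘ {g} g∈G f∈Ḡ F with f∈Ḡ F
  ... | h , h∈G , agrees = g ∘ h , ∘-closed g∈G h∈G , cong g ∘ agrees

  InTypeset-closed : ∀ {f F p q} → InClosure G f → (∀ {x} → x ∈ F → f x ≡ x) →
    InTypeset G F p q → InTypeset G F p (f q)
  InTypeset-closed {F = F} {q = q} f∈Ḡ f-fixes (g₀ , (g₀∈G , g₀-fixes) , g₀p≡q)
    with f∈Ḡ (q ∷ F)
  ... | g , g∈G , agrees =
    g ∘ g₀ ,
    (∘-closed g∈G g₀∈G ,
     λ x∈F → trans (cong g (g₀-fixes x∈F)) (trans (sym (agrees (there x∈F))) (f-fixes x∈F))) ,
    trans (cong g g₀p≡q) (sym (agrees (here refl)))

  Ranked⇒preimage : ∀ {F p f} → Ranked G F p → InClosure G f → (∀ {x} → x ∈ F → f x ≡ x) →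
    ∃ λ u → f u ≡ p
  Ranked⇒preimage {F} {p} {f} (rank0 (xs , covered)) f∈Ḡ f-fixes =
    finite-orbit⇒preimage (InClosure-injective f∈Ḡ) xs (covered ∘ orbit)
    where
    orbit : ∀ n → InTypeset G F p (fold p f n)
    orbit 0       = (λ x → x) , (id-closed , λ _ → refl) , refl
    orbit (suc n) = InTypeset-closed f∈Ḡ f-fixes (orbit n)
  Ranked⇒preimage {F} {p} {f} (rankS F' F⊆F' ranked) f∈Ḡ f-fixes with f∈Ḡ F'
  ... | g , g∈G , agrees
    with Ranked⇒preimage (ranked _ g⁻¹p∈typeset) (InClosure-∘ (inverse∈G g∈G) f∈Ḡ) g⁻¹∘f-fixes
    where
    g⁻¹p∈typeset : InTypeset G F p (inverse g∈G p)
    g⁻¹p∈typeset =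
      inverse g∈G , inverse-fixes g∈G (λ x∈F → trans (sym (agrees (F⊆F' x∈F))) (f-fixes x∈F)) , refl

    g⁻¹∘f-fixes : ∀ {x} → x ∈ F' → inverse g∈G (f x) ≡ x
    g⁻¹∘f-fixes {x} x∈F' = trans (cong (inverse g∈G) (agrees x∈F')) (inverse-cancelˡ g∈G x)
  ... | u , g⁻¹fu≡g⁻¹p = u , (begin
    f u                    ≡⟨ inverse-cancelʳ g∈G (f u) ⟨
    g (inverse g∈G (f u))  ≡⟨ cong g g⁻¹fu≡g⁻¹p ⟩
    g (inverse g∈G p)      ≡⟨ inverse-cancelʳ g∈G p ⟩
    p                      ∎)
    where open ≡-Reasoning

  unranked-extend : ExcludedMiddle 0ℓ → ∀ {E p} → ¬ Ranked G E p → (c : U) →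
    ∃ λ h → Fixes G E h × ¬ Ranked G (h c ∷ E) p
  unranked-extend em {E} {p} unranked c
    with em {∃ λ q → InTypeset G E p q × ¬ Ranked G (c ∷ E) q}
  ... | yes (q , (g , (g∈G , g-fixes) , gp≡q) , q-unranked) =
    inverse g∈G , inverse-fixes g∈G g-fixes , λ ranked →
      q-unranked (subst (Ranked G (c ∷ E)) gp≡q (Ranked-weaken moved (Ranked-map g∈G ranked)))
    where
    moved : map g (inverse g∈G c ∷ E) ⊆ c ∷ E
    moved (here refl) = here (inverse-cancelʳ g∈G c)
    moved (there y∈gE) with ∈-map⁻ g y∈gE
    ... | x , x∈E , refl = there (subst (_∈ E) (sym (g-fixes x∈E)) x∈E)
  ... | no no-unranked-successor = ⊥-elim (unranked (rankS (c ∷ E) there ranked))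
    where
    ranked : ∀ q → InTypeset G E p q → Ranked G (c ∷ E) q
    ranked q q∈ with em {Ranked G (c ∷ E) q}
    ... | yes q-ranked   = q-ranked
    ... | no q-unranked = ⊥-elim (no-unranked-successor (q , q∈ , q-unranked))

  module Limit (em : ExcludedMiddle 0ℓ)
               (to : U → ℕ) (from : ℕ → U) (from∘to : ∀ u → from (to u) ≡ u)
               {p : U} (p-unranked : ¬ Ranked G [] p) where

    record Stage (n : ℕ) : Set where
      field
        g        : U → U
        g∈G      : G g
        E        : List U
        unranked : ¬ Ranked G E p
        placed   : ∀ {k} → k < n → g (from k) ∈ E
    open Stage

    extension : ∀ {n} (s : Stage n) →
      ∃ λ h → Fixes G (E s) h × ¬ Ranked G (h (g s (from n)) ∷ E s) p
    extension {n} s = unranked-extend em (unranked s) (g s (from n))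

    next : ∀ {n} → Stage n → Stage (suc n)
    next {n} s = grow (extension s)
      where
      grow : (∃ λ h → Fixes G (E s) h × ¬ Ranked G (h (g s (from n)) ∷ E s) p) → Stage (suc n)
      grow (h , (h∈G , h-fixes) , still-unranked) = record
        { g        = h ∘ g s
        ; g∈G      = ∘-closed h∈G (g∈G s)
        ; E        = h (g s (from n)) ∷ E s
        ; unranked = still-unranked
        ; placed   = placed′
        }
        where
        placed′ : ∀ {k} → k < suc n → h (g s (from k)) ∈ h (g s (from n)) ∷ E s
        placed′ (s≤s k≤n) with m≤n⇒m<n∨m≡n k≤n
        ... | inj₂ refl = here refl
        ... | inj₁ k<n  = there (subst (_∈ E s) (sym (h-fixes (placed s k<n))) (placed s k<n))

    next-agrees : ∀ {n k} (s : Stage n) → k < n → g (next s) (from k) ≡ g s (from k)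
    next-agrees s k<n = proj₂ (proj₁ (proj₂ (extension s))) (placed s k<n)

    stage : ∀ n → Stage n
    stage 0       = record
      { g = λ x → x ; g∈G = id-closed ; E = [] ; unranked = p-unranked ; placed = λ () }
    stage (suc n) = next (stage n)

    stage-stable : ∀ {k m} → k < m → g (stage m) (from k) ≡ g (stage (suc k)) (from k)
    stage-stable {k} {suc m} (s≤s k≤m) with m≤n⇒m<n∨m≡n k≤m
    ... | inj₂ refl = refl
    ... | inj₁ k<m  = trans (next-agrees (stage m) k<m) (stage-stable k<m)

    limit : U → U
    limit u = g (stage (suc (to u))) u

    limit-agrees : ∀ {u m} → to u < m → g (stage m) u ≡ limit u
    limit-agrees {u} {m} to-u<m =
      subst (λ x → g (stage m) x ≡ g (stage (suc (to u))) x) (from∘to u) (stage-stable to-u<m)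

    limit∈Ḡ : InClosure G limit
    limit∈Ḡ L = g (stage n) , g∈G (stage n) , λ u∈L →
      sym (limit-agrees (s≤s (All.lookup (xs≤max 0 (map to L)) (∈-map⁺ to u∈L))))
      where
      n : ℕ
      n = suc (max 0 (map to L))

    limit-misses : ∀ u → limit u ≢ p
    limit-misses u limit-u≡p =
      unranked s (Ranked-∈ (subst (_∈ E s) stage-value≡p (placed s ≤-refl)))
      where
      s : Stage (suc (to u))
      s = stage (suc (to u))

      stage-value≡p : g s (from (to u)) ≡ p
      stage-value≡p = trans (cong (g s) (from∘to u)) limit-u≡p

  unranked⇒closure-misses : ExcludedMiddle 0ℓ → U ↔ ℕ → ∀ {p} → ¬ Ranked G [] p →
    ∃ λ f → InClosure G f × ∀ u → f u ≢ p
  unranked⇒closure-misses em iso p-unranked = limit , limit∈Ḡ , limit-misses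
    where
    open Inverse iso using (to; from; strictlyInverseʳ)
    open Limit em to from strictlyInverseʳ p-unranked

corollary7p11 : ExcludedMiddle 0ℓ →
    (U : Set) → U ↔ ℕ →
    (G : (U → U) → Set) → IsSubgroupOfSym U G →
    ((f : U → U) → InClosure G f → ImageIsU G f)
      ⇔ ((x : U) → Ranked G [] x)
corollary7p11 em U iso G S = mk⇔ surjective⇒ranked ranked⇒surjective
  where
  open Ranks G S

  ranked⇒surjective : ((x : U) → Ranked G [] x) → (f : U → U) → InClosure G f → ImageIsU G f
  ranked⇒surjective ranked f f∈Ḡ y = Ranked⇒preimage (ranked y) f∈Ḡ λ ()

  surjective⇒ranked : ((f : U → U) → InClosure G f → ImageIsU G f) → (x : U) → Ranked G [] x
  surjective⇒ranked surjective x with em {Ranked G [] x}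
  ... | yes x-ranked   = x-ranked
  ... | no x-unranked =
    let f , f∈Ḡ , misses = unranked⇒closure-misses em iso x-unranked
        u , fu≡x = surjective f f∈Ḡ x
    in ⊥-elim (misses u fu≡x)
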